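{- Let $q=2^m$, let $1<t<q$ be an integer, and let $N=(q+1)(t-1)$. There is no extended cyclic code over $\mathbb{F}_q$ with parameters $[N+1,3,N+1-t]$ whose dual code has minimum distance $d^\perp=2$.
   Context: A linear code of length $n$ is cyclic if it is invariant under the cyclic shift of coordinates. The extended code of a linear code $C$ of length $n$ is $\{(c_0,\dots,c_{n-1},-\sum_i c_i):(c_0,\dots,c_{n-1})\in C\}$; an extended cyclic code is the extended code of a cyclic code. The dual code is taken with respect to the standard inner product. -}

module Defs where

open import Level using (0ℓ)
open import Data.Nat using (ℕ; zero; suc; _≤_)
open import Data.Fin using (Fin; zero; suc)
open import Data.Product using (Σ; ∃; _×_; _,_)
open import Relation.Nullary using (¬_; yes; no)
open import Relation.Binary.Definitions using (DecidableEquality)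
open import Relation.Binary.PropositionalEquality using (_≡_)
open import Algebra.Structures using (IsCommutativeRing)
open import Function.Bundles using (_↔_)

record FiniteField (q : ℕ) : Set₁ where
  infixl 6 _+_
  infixl 7 _*_
  field
    Carrier : Set
    _+_ _*_ : Carrier → Carrier → Carrier
    -_      : Carrier → Carrier
    0# 1#   : Carrier
    isCommutativeRing : IsCommutativeRing _≡_ _+_ _*_ -_ 0# 1#
    0≢1     : ¬ (0# ≡ 1#)
    inv     : (x : Carrier) → ¬ (x ≡ 0#) → Carrier
    inv-law : (x : Carrier) (p : ¬ (x ≡ 0#)) → x * inv x p ≡ 1#
    _≟_     : DecidableEquality Carrier
    enum    : Carrier ↔ Fin q

module Codes {q : ℕ} (F : FiniteField q) where
  open FiniteField F

  Word : ℕ → Set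
  Word n = Fin n → Carrier

  Code : ℕ → Set₁
  Code n = Word n → Set

  sumF : ∀ {n} → Word n → Carrier
  sumF {zero}  c = 0#
  sumF {suc n} c = c zero + sumF (λ i → c (suc i))

  _·_ : ∀ {n} → Word n → Word n → Carrier
  u · v = sumF (λ i → u i * v i)

  IsZeroWord : ∀ {n} → Word n → Set
  IsZeroWord c = ∀ i → c i ≡ 0#

  record IsLinear {n : ℕ} (C : Code n) : Set where
    field
      zero∈ : C (λ _ → 0#)
      +∈    : ∀ u v → C u → C v → C (λ i → u i + v i)
      *∈    : ∀ a u → C u → C (λ i → a * u i)
      -- C is a predicate on functions: closed under pointwise equality
      resp  : ∀ u v → (∀ i → u i ≡ v i) → C u → C v

  HasDimension : ∀ {n} → Code n → ℕ → Set
  HasDimension {n} C k =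
    Σ (Fin k → Word n) λ b →
      (∀ j → C (b j)) ×
      (∀ (a : Fin k → Carrier) →
         (∀ i → sumF (λ j → a j * b j i) ≡ 0#) → ∀ j → a j ≡ 0#) ×
      (∀ c → C c → ∃ λ (a : Fin k → Carrier) →
         ∀ i → c i ≡ sumF (λ j → a j * b j i))

  wt : ∀ {n} → Word n → ℕ
  wt {zero}  c = 0
  wt {suc n} c with c zero ≟ 0#
  ... | yes _ = wt (λ i → c (suc i))
  ... | no  _ = suc (wt (λ i → c (suc i)))

  HasMinDistance : ∀ {n} → Code n → ℕ → Set
  HasMinDistance C d =
    (∃ λ c → C c × ¬ IsZeroWord c × wt c ≡ d) ×
    (∀ c → C c → ¬ IsZeroWord c → d ≤ wt c)

  HasParams : ∀ {n} → Code n → ℕ → ℕ → Set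
  HasParams C k d = IsLinear C × HasDimension C k × HasMinDistance C d

  -- cyclic shift: (c_0,...,c_{n-1}) ↦ (c_{n-1},c_0,...,c_{n-2})
  lastF : ∀ {n} → Word (suc n) → Carrier
  lastF {zero}  c = c zero
  lastF {suc n} c = lastF (λ i → c (suc i))

  initF : ∀ {n} → Word (suc n) → Word n
  initF c i = c (Data.Fin.inject₁ i)

  shift : ∀ {n} → Word n → Word n
  shift {zero}  c ()
  shift {suc n} c zero    = lastF c
  shift {suc n} c (suc i) = initF c i

  IsCyclic : ∀ {n} → Code n → Set
  IsCyclic C = IsLinear C × (∀ c → C c → C (shift c))

  snoc : ∀ {n} → Word n → Carrier → Word (suc n)
  snoc {zero}  c a zero    = a
  snoc {suc n} c a zero    = c zero
  snoc {suc n} c a (suc i) = snoc (λ j → c (suc j)) a i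

  extend : ∀ {n} → Code n → Code (suc n)
  extend C w = ∃ λ c → C c × (∀ i → w i ≡ snoc c (- sumF c) i)

  dual : ∀ {n} → Code n → Code n
  dual C v = ∀ c → C c → v · c ≡ 0#

module Submission where

-- If w is supported on {i, j}, every codeword vanishing at i also vanishes at j.
-- The codewords vanishing at i contain a projective line: q + 1 nonzero codewords V and U + x V
-- (x ∈ F), each of weight at least d. At every coordinate at least one of them vanishes, and at i
-- and j all of them do, so counting their nonzero entries gives (q + 1) d + 2 q ≤ n q. For
-- n = (q + 1)(t - 1) + 1 and d = n - t = q (t - 1) the left side exceeds the right one by q.

open import Defs
open import Level using (0ℓ)
open import Data.Nat using (ℕ; zero; suc; _≤_; z≤n; s≤s)
import Data.Nat as ℕ
import Data.Nat.Properties as ℕ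
open import Data.Fin using (Fin; zero; suc; punchIn)
open import Data.Vec.Functional using (Vector; removeAt; []; _∷_)
open import Data.Product using (∃; ∃₂; _×_; _,_; proj₁; proj₂)
open import Data.Empty using (⊥-elim)
open import Function using (_∘_; Inverse)
open import Relation.Nullary using (¬_; yes; no)
open import Relation.Binary.PropositionalEquality
open import Algebra.Bundles using (CommutativeRing)
open import Algebra.Properties.CommutativeMonoid.Sum ℕ.+-0-commutativeMonoid
  using (sum; sum-remove; ∑-comm; sum-cong-≗; sum-replicate-zero)
import Algebra.Properties.Semiring.Sum as SemiringSum
import Algebra.Solver.Ring.NaturalCoefficients.Default as SemiringSolver

module FieldLemmas {q : ℕ} (F : FiniteField q) where
  open FiniteField F
  open Codes F

  ring : CommutativeRing 0ℓ 0ℓ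
  ring = record { isCommutativeRing = isCommutativeRing }

  open CommutativeRing ring
    using ( semiring; commutativeSemiring; zeroˡ; zeroʳ; +-identityˡ; +-identityʳ; +-comm
          ; *-identityˡ; *-identityʳ; distribʳ; -‿inverseˡ)
  module F = SemiringSum semiring
  open SemiringSolver commutativeSemiring using (solve; _:+_; _:*_; _:=_; con)

  sumF≡sum : ∀ {n} (c : Word n) → sumF c ≡ F.sum c
  sumF≡sum {zero}  c = refl
  sumF≡sum {suc n} c = cong (c zero +_) (sumF≡sum (c ∘ suc))

  sum-zero : ∀ {n} (c : Word n) → IsZeroWord c → F.sum c ≡ 0#
  sum-zero {n} c c≡0 = trans (F.sum-cong-≗ c≡0) (F.sum-replicate-zero n)

  *-cancel-zero : ∀ x y → ¬ x ≡ 0# → x * y ≡ 0# → y ≡ 0#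
  *-cancel-zero x y x≢0 xy≡0 = begin
    y                ≡⟨ *-identityˡ y ⟨
    1# * y           ≡⟨ cong (_* y) (inv-law x x≢0) ⟨
    (x * x⁻¹) * y    ≡⟨ solve 3 (λ x x⁻¹ y → (x :* x⁻¹) :* y := x⁻¹ :* (x :* y)) refl x x⁻¹ y ⟩
    x⁻¹ * (x * y)    ≡⟨ cong (x⁻¹ *_) xy≡0 ⟩
    x⁻¹ * 0#         ≡⟨ zeroʳ x⁻¹ ⟩
    0#               ∎
    where
    open ≡-Reasoning
    x⁻¹ = inv x x≢0

  -*+*≡0 : ∀ a b → (- a) * b + a * b ≡ 0#
  -*+*≡0 a b = trans (sym (distribʳ b (- a) a)) (trans (cong (_* b) (-‿inverseˡ a)) (zeroˡ b))

  +*0 : ∀ x y → x + y * 0# ≡ x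
  +*0 x y = trans (cong (x +_) (zeroʳ y)) (+-identityʳ x)

  wt₁ : Carrier → ℕ
  wt₁ x with x ≟ 0#
  ... | yes _ = 0
  ... | no  _ = 1

  wt₁-≤1 : ∀ x → wt₁ x ≤ 1
  wt₁-≤1 x with x ≟ 0#
  ... | yes _ = z≤n
  ... | no  _ = s≤s z≤n

  wt₁-zero : ∀ {x} → x ≡ 0# → wt₁ x ≡ 0
  wt₁-zero {x} x≡0 with x ≟ 0#
  ... | yes _   = refl
  ... | no  x≢0 = ⊥-elim (x≢0 x≡0)

  wt₁-nonzero : ∀ {x} → ¬ x ≡ 0# → wt₁ x ≡ 1
  wt₁-nonzero {x} x≢0 with x ≟ 0#
  ... | yes x≡0 = ⊥-elim (x≢0 x≡0)
  ... | no  _   = refl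

  wt≡∑wt₁ : ∀ {n} (c : Word n) → wt c ≡ sum (wt₁ ∘ c)
  wt≡∑wt₁ {zero}  c = refl
  wt≡∑wt₁ {suc n} c with c zero ≟ 0#
  ... | yes _ = wt≡∑wt₁ (c ∘ suc)
  ... | no  _ = cong suc (wt≡∑wt₁ (c ∘ suc))

  wt≡0⇒zero : ∀ {n} (c : Word n) → wt c ≡ 0 → IsZeroWord c
  wt≡0⇒zero {suc n} c wt≡0 i with c zero ≟ 0# | i
  ... | yes c₀≡0 | zero  = c₀≡0
  ... | yes _    | suc i = wt≡0⇒zero (c ∘ suc) wt≡0 i

  wt≡suc⇒nonzero : ∀ {n k} (c : Word n) → wt c ≡ suc k → ∃ λ i → ¬ c i ≡ 0#
  wt≡suc⇒nonzero {suc n} c wt≡1+k with c zero ≟ 0#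
  ... | yes _   = let i , cᵢ≢0 = wt≡suc⇒nonzero (c ∘ suc) wt≡1+k in suc i , cᵢ≢0
  ... | no  c₀≢0 = zero , c₀≢0

  wt-removeAt : ∀ {n} (c : Word (suc n)) i → ¬ c i ≡ 0# → wt c ≡ suc (wt (removeAt c i))
  wt-removeAt c i cᵢ≢0 = begin
    wt c                                   ≡⟨ wt≡∑wt₁ c ⟩
    sum (wt₁ ∘ c)                          ≡⟨ sum-remove (wt₁ ∘ c) ⟩
    wt₁ (c i) ℕ.+ sum (wt₁ ∘ removeAt c i)
      ≡⟨ cong₂ ℕ._+_ (wt₁-nonzero cᵢ≢0) (sym (wt≡∑wt₁ (removeAt c i))) ⟩
    suc (wt (removeAt c i))                ∎
    where
    open ≡-Reasoning

  ·-removeAt : ∀ {n} (u v : Word (suc n)) i → u · v ≡ u i * v i + removeAt u i · removeAt v i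
  ·-removeAt u v i = begin
    u · v                                   ≡⟨ sumF≡sum uv ⟩
    F.sum uv                                ≡⟨ F.sum-remove uv ⟩
    u i * v i + F.sum (removeAt uv i)       ≡⟨ cong (u i * v i +_) (sumF≡sum (removeAt uv i)) ⟨
    u i * v i + removeAt u i · removeAt v i ∎
    where
    open ≡-Reasoning
    uv = λ k → u k * v k

  ·-zeroˡ : ∀ {n} (u v : Word n) → IsZeroWord u → u · v ≡ 0#
  ·-zeroˡ u v u≡0 =
    trans (sumF≡sum uv) (sum-zero uv (λ k → trans (cong (_* v k) (u≡0 k)) (zeroˡ (v k))))
    where uv = λ k → u k * v k

  weight-one-support : ∀ {n} (u : Word n) → wt u ≡ 1 →
    ∃ λ j → ¬ u j ≡ 0# × (∀ v → u · v ≡ u j * v j)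
  weight-one-support {suc n} u wt≡1 = j , uⱼ≢0 , u·v≡uⱼvⱼ
    where
    j = proj₁ (wt≡suc⇒nonzero u wt≡1)
    uⱼ≢0 = proj₂ (wt≡suc⇒nonzero u wt≡1)
    rest≡0 : IsZeroWord (removeAt u j)
    rest≡0 = wt≡0⇒zero (removeAt u j)
      (ℕ.suc-injective (trans (sym (wt-removeAt u j uⱼ≢0)) wt≡1))
    u·v≡uⱼvⱼ : ∀ v → u · v ≡ u j * v j
    u·v≡uⱼvⱼ v = begin
      u · v                                   ≡⟨ ·-removeAt u v j ⟩
      u j * v j + removeAt u j · removeAt v j ≡⟨ cong (u j * v j +_) (·-zeroˡ _ _ rest≡0) ⟩
      u j * v j + 0#                          ≡⟨ +-identityʳ _ ⟩
      u j * v j                               ∎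
      where open ≡-Reasoning

  weight-two-support : ∀ {n} (w : Word (suc n)) → wt w ≡ 2 →
    ∃₂ λ i j → ¬ w (punchIn i j) ≡ 0# ×
      (∀ v → w · v ≡ w i * v i + w (punchIn i j) * v (punchIn i j))
  weight-two-support w wt≡2 = i , j , wⱼ≢0 , w·v≡
    where
    i = proj₁ (wt≡suc⇒nonzero w wt≡2)
    wᵢ≢0 = proj₂ (wt≡suc⇒nonzero w wt≡2)
    support = weight-one-support (removeAt w i)
      (ℕ.suc-injective (trans (sym (wt-removeAt w i wᵢ≢0)) wt≡2))
    j = proj₁ support
    wⱼ≢0 = proj₁ (proj₂ support)
    w·v≡ : ∀ v → w · v ≡ w i * v i + w (punchIn i j) * v (punchIn i j)
    w·v≡ v = trans (·-removeAt w v i) (cong (w i * v i +_) (proj₂ (proj₂ support) (removeAt v i)))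

  root : ∀ u v → ¬ v ≡ 0# → ∃ λ x → u + x * v ≡ 0#
  root u v v≢0 = - w , (begin
    u + - w * v      ≡⟨ cong (_+ - w * v) u≡wv ⟩
    w * v + - w * v  ≡⟨ +-comm (w * v) (- w * v) ⟩
    - w * v + w * v  ≡⟨ -*+*≡0 w v ⟩
    0#               ∎)
    where
    open ≡-Reasoning
    v⁻¹ = inv v v≢0
    w = u * v⁻¹
    u≡wv : u ≡ w * v
    u≡wv = begin
      u                ≡⟨ *-identityʳ u ⟨
      u * 1#           ≡⟨ cong (u *_) (inv-law v v≢0) ⟨
      u * (v * v⁻¹)    ≡⟨ solve 3 (λ u v v⁻¹ → u :* (v :* v⁻¹) := (u :* v⁻¹) :* v) refl u v v⁻¹ ⟩
      w * v            ∎

  combination : ∀ {k n} → (Fin k → Carrier) → (Fin k → Word n) → Word n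
  combination a b p = sumF (λ l → a l * b l p)

  combination-∈ : ∀ {k n} {E : Code n} → IsLinear E →
    (a : Fin k → Carrier) (b : Fin k → Word n) → (∀ l → E (b l)) → E (combination a b)
  combination-∈ {zero}  E-linear a b b∈E = IsLinear.zero∈ E-linear
  combination-∈ {suc k} E-linear a b b∈E =
    IsLinear.+∈ E-linear _ _ (IsLinear.*∈ E-linear (a zero) (b zero) (b∈E zero))
      (combination-∈ E-linear (a ∘ suc) (b ∘ suc) (b∈E ∘ suc))

  combination-+* : ∀ {k n} (a a′ : Fin k → Carrier) x (b : Fin k → Word n) p →
    combination (λ l → a l + x * a′ l) b p ≡ combination a b p + x * combination a′ b p
  combination-+* {zero}  a a′ x b p = solve 1 (λ x → con 0 := con 0 :+ x :* con 0) refl x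
  combination-+* {suc k} a a′ x b p = begin
    (a₀ + x * a′₀) * b₀ + combination (λ l → a (suc l) + x * a′ (suc l)) (b ∘ suc) p
      ≡⟨ cong ((a₀ + x * a′₀) * b₀ +_) (combination-+* (a ∘ suc) (a′ ∘ suc) x (b ∘ suc) p) ⟩
    (a₀ + x * a′₀) * b₀ + (s + x * s′)
      ≡⟨ solve 6 (λ a₀ a′₀ b₀ s s′ x → (a₀ :+ x :* a′₀) :* b₀ :+ (s :+ x :* s′)
                                      := (a₀ :* b₀ :+ s) :+ x :* (a′₀ :* b₀ :+ s′))
                 refl a₀ a′₀ b₀ s s′ x ⟩
    (a₀ * b₀ + s) + x * (a′₀ * b₀ + s′)
      ∎
    where
    open ≡-Reasoning
    a₀ = a zero
    a′₀ = a′ zero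
    b₀ = b zero p
    s = combination (a ∘ suc) (b ∘ suc) p
    s′ = combination (a′ ∘ suc) (b ∘ suc) p

  record KernelPair (β : Word 3) : Set where
    field
      A B    : Word 3
      A⊥β    : A · β ≡ 0#
      B⊥β    : B · β ≡ 0#
      B≢0    : ¬ IsZeroWord B
      A+xB≢0 : ∀ x → ¬ IsZeroWord (λ l → A l + x * B l)

  kernel-pair : ∀ β₀ β₁ β₂ → KernelPair (β₀ ∷ β₁ ∷ β₂ ∷ [])
  kernel-pair β₀ β₁ β₂ with β₀ ≟ 0# | β₁ ≟ 0#
  ... | no β₀≢0 | _ = record
    { A      = - β₁ ∷ β₀ ∷ 0# ∷ []
    ; B      = - β₂ ∷ 0# ∷ β₀ ∷ []
    ; A⊥β    = trans (solve 4 (λ β₀ β₁ β₂ -β₁ → -β₁ :* β₀ :+ (β₀ :* β₁ :+ (con 0 :* β₂ :+ con 0))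
                                                := -β₁ :* β₀ :+ β₁ :* β₀) refl β₀ β₁ β₂ (- β₁))
                     (-*+*≡0 β₁ β₀)
    ; B⊥β    = trans (solve 4 (λ β₀ β₁ β₂ -β₂ → -β₂ :* β₀ :+ (con 0 :* β₁ :+ (β₀ :* β₂ :+ con 0))
                                                := -β₂ :* β₀ :+ β₂ :* β₀) refl β₀ β₁ β₂ (- β₂))
                     (-*+*≡0 β₂ β₀)
    ; B≢0    = λ B≡0 → β₀≢0 (B≡0 (suc (suc zero)))
    ; A+xB≢0 = λ x A+xB≡0 → β₀≢0 (trans (sym (+*0 β₀ x)) (A+xB≡0 (suc zero)))
    }
  ... | yes β₀≡0 | no β₁≢0 = record
    { A      = 1# ∷ 0# ∷ 0# ∷ []
    ; B      = 0# ∷ - β₂ ∷ β₁ ∷ []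
    ; A⊥β    = trans (solve 3 (λ β₀ β₁ β₂ → con 1 :* β₀ :+ (con 0 :* β₁ :+ (con 0 :* β₂ :+ con 0))
                                           := β₀) refl β₀ β₁ β₂)
                     β₀≡0
    ; B⊥β    = trans (solve 4 (λ β₀ β₁ β₂ -β₂ → con 0 :* β₀ :+ (-β₂ :* β₁ :+ (β₁ :* β₂ :+ con 0))
                                                := -β₂ :* β₁ :+ β₂ :* β₁) refl β₀ β₁ β₂ (- β₂))
                     (-*+*≡0 β₂ β₁)
    ; B≢0    = λ B≡0 → β₁≢0 (B≡0 (suc (suc zero)))
    ; A+xB≢0 = λ x A+xB≡0 → 0≢1 (sym (trans (sym (+*0 1# x)) (A+xB≡0 zero)))
    }
  ... | yes β₀≡0 | yes β₁≡0 = record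
    { A      = 1# ∷ 0# ∷ 0# ∷ []
    ; B      = 0# ∷ 1# ∷ 0# ∷ []
    ; A⊥β    = trans (solve 3 (λ β₀ β₁ β₂ → con 1 :* β₀ :+ (con 0 :* β₁ :+ (con 0 :* β₂ :+ con 0))
                                           := β₀) refl β₀ β₁ β₂)
                     β₀≡0
    ; B⊥β    = trans (solve 3 (λ β₀ β₁ β₂ → con 0 :* β₀ :+ (con 1 :* β₁ :+ (con 0 :* β₂ :+ con 0))
                                           := β₁) refl β₀ β₁ β₂)
                     β₁≡0
    ; B≢0    = λ B≡0 → 0≢1 (sym (B≡0 (suc zero)))
    ; A+xB≢0 = λ x A+xB≡0 → 0≢1 (sym (trans (sym (+*0 1# x)) (A+xB≡0 zero)))
    }

  record Pencil {n} (E : Code n) (i : Fin n) : Set where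
    field
      U V    : Word n
      U∈E    : E U
      V∈E    : E V
      Uᵢ≡0   : U i ≡ 0#
      Vᵢ≡0   : V i ≡ 0#
      V≢0    : ¬ IsZeroWord V
      U+xV≢0 : ∀ x → ¬ IsZeroWord (λ p → U p + x * V p)

  pencil : ∀ {n} {E : Code n} → IsLinear E → HasDimension E 3 → ∀ i → Pencil E i
  pencil {E = E} E-linear (b , b∈E , independent , _) i = record
    { U      = combination A b
    ; V      = combination B b
    ; U∈E    = combination-∈ E-linear A b b∈E
    ; V∈E    = combination-∈ E-linear B b b∈E
    ; Uᵢ≡0   = A⊥β
    ; Vᵢ≡0   = B⊥β
    ; V≢0    = λ V≡0 → B≢0 (independent B V≡0)
    ; U+xV≢0 = λ x U+xV≡0 → A+xB≢0 x (independent (λ l → A l + x * B l)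
                 (λ p → trans (combination-+* A B x b p) (U+xV≡0 p)))
    }
    where
    open KernelPair (kernel-pair (b zero i) (b (suc zero) i) (b (suc (suc zero)) i))

  module Line {n} {E : Code n} {i : Fin n} (E-linear : IsLinear E) (P : Pencil E i) where
    open Pencil P
    open Inverse enum using (to; from; strictlyInverseʳ)

    -- the q + 1 points of the projective line through U and V, enumerated via enum : F ↔ Fin q
    line : Fin (suc q) → Word n
    line zero    = V
    line (suc k) = λ p → U p + from k * V p

    line-∈ : ∀ k → E (line k)
    line-∈ zero    = V∈E
    line-∈ (suc k) = IsLinear.+∈ E-linear U _ U∈E (IsLinear.*∈ E-linear (from k) V V∈E)

    line≢0 : ∀ k → ¬ IsZeroWord (line k)
    line≢0 zero    = V≢0
    line≢0 (suc k) = U+xV≢0 (from k)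

    line-vanishes : ∀ k → line k i ≡ 0#
    line-vanishes zero    = Vᵢ≡0
    line-vanishes (suc k) = trans (cong₂ (λ u v → u + from k * v) Uᵢ≡0 Vᵢ≡0) (+*0 0# (from k))

    line-covers : ∀ p → ∃ λ k → line k p ≡ 0#
    line-covers p with V p ≟ 0#
    ... | yes Vₚ≡0 = zero , Vₚ≡0
    ... | no  Vₚ≢0 = let x , Uₚ+xVₚ≡0 = root (U p) (V p) Vₚ≢0 in
      suc (to x) , trans (cong (λ y → U p + y * V p) (strictlyInverseʳ x)) Uₚ+xVₚ≡0

  dual-weight-two-propagates : ∀ {n} {E : Code (suc n)} w → dual E w → wt w ≡ 2 →
    ∃₂ λ i j → ∀ c → E c → c i ≡ 0# → c (punchIn i j) ≡ 0#
  dual-weight-two-propagates {E = E} w w∈E⊥ wt≡2 = i , j , propagates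
    where
    open ≡-Reasoning
    support = weight-two-support w wt≡2
    i = proj₁ support
    j = proj₁ (proj₂ support)
    j′ = punchIn i j
    wⱼ≢0 = proj₁ (proj₂ (proj₂ support))
    propagates : ∀ c → E c → c i ≡ 0# → c j′ ≡ 0#
    propagates c c∈E cᵢ≡0 = *-cancel-zero (w j′) (c j′) wⱼ≢0 (begin
      w j′ * c j′                ≡⟨ +-identityˡ _ ⟨
      0# + w j′ * c j′           ≡⟨ cong (_+ w j′ * c j′) (trans (cong (w i *_) cᵢ≡0) (zeroʳ (w i))) ⟨
      w i * c i + w j′ * c j′    ≡⟨ proj₂ (proj₂ (proj₂ support)) c ⟨
      w · c                      ≡⟨ w∈E⊥ c c∈E ⟩
      0#                         ∎)

-- ℕ's _+_ and _*_ are opened only here: above they would clash with the field operations.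
open import Data.Nat using (_+_; _*_; _∸_; _^_; _<_)
open import Data.Nat.Solver using (module +-*-Solver)

∑-≤ : ∀ {n b} (f : Vector ℕ n) → (∀ p → f p ≤ b) → sum f ≤ n * b
∑-≤ {zero}  f f≤b = z≤n
∑-≤ {suc n} f f≤b = ℕ.+-mono-≤ (f≤b zero) (∑-≤ (f ∘ suc) (f≤b ∘ suc))

≤-∑ : ∀ {n d} (f : Vector ℕ n) → (∀ p → d ≤ f p) → n * d ≤ sum f
≤-∑ {zero}  f d≤f = z≤n
≤-∑ {suc n} f d≤f = ℕ.+-mono-≤ (d≤f zero) (≤-∑ (f ∘ suc) (d≤f ∘ suc))

sum-removeAt-zero : ∀ {n} (f : Vector ℕ (suc n)) i → f i ≡ 0 → sum f ≡ sum (removeAt f i)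
sum-removeAt-zero f i fᵢ≡0 = trans (sum-remove f) (cong (_+ sum (removeAt f i)) fᵢ≡0)

∑-≤-vanishing : ∀ {n b} (f : Vector ℕ (suc n)) i → (∀ p → f p ≤ b) → f i ≡ 0 →
  sum f ≤ n * b
∑-≤-vanishing f i f≤b fᵢ≡0 rewrite sum-removeAt-zero f i fᵢ≡0 =
  ∑-≤ (removeAt f i) (f≤b ∘ punchIn i)

∑-≤-vanishing-twice : ∀ {n b} (f : Vector ℕ (suc n)) i j → (∀ p → f p ≤ b) →
  f i ≡ 0 → f (punchIn i j) ≡ 0 → sum f + (b + b) ≤ suc n * b
∑-≤-vanishing-twice {suc n} {b} f i j f≤b fᵢ≡0 fⱼ≡0 = begin
  sum f + (b + b)                ≡⟨ cong (_+ (b + b)) (sum-removeAt-zero f i fᵢ≡0) ⟩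
  sum (removeAt f i) + (b + b)
    ≤⟨ ℕ.+-monoˡ-≤ (b + b) (∑-≤-vanishing (removeAt f i) j (f≤b ∘ punchIn i) fⱼ≡0) ⟩
  n * b + (b + b)                ≡⟨ solve 2 (λ n b → n :* b :+ (b :+ b) := (con 2 :+ n) :* b) refl n b ⟩
  suc (suc n) * b                ∎
  where
  open ℕ.≤-Reasoning
  open +-*-Solver

double-count : ∀ {r n d} (M : Fin (suc r) → Fin (suc n) → ℕ) i j →
  (∀ k p → M k p ≤ 1) → (∀ k → d ≤ sum (M k)) → (∀ p → ∃ λ k → M k p ≡ 0) →
  (∀ k → M k i ≡ 0) → (∀ k → M k (punchIn i j) ≡ 0) →
  suc r * d + (r + r) ≤ suc n * r
double-count {r} {n} {d} M i j M≤1 d≤row column-has-zero Mᵢ≡0 Mⱼ≡0 = begin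
  suc r * d + (r + r)         ≤⟨ ℕ.+-monoˡ-≤ (r + r) (≤-∑ (sum ∘ M) d≤row) ⟩
  sum (sum ∘ M) + (r + r)     ≡⟨ cong (_+ (r + r)) (∑-comm M) ⟩
  sum column + (r + r)
    ≤⟨ ∑-≤-vanishing-twice column i j column≤r (column-zero Mᵢ≡0) (column-zero Mⱼ≡0) ⟩
  suc n * r                   ∎
  where
  open ℕ.≤-Reasoning
  column : Fin (suc n) → ℕ
  column p = sum (λ k → M k p)
  column-zero : ∀ {p} → (∀ k → M k p ≡ 0) → column p ≡ 0
  column-zero M≡0 = trans (sum-cong-≗ M≡0) (sum-replicate-zero (suc r))
  column≤r : ∀ p → column p ≤ r
  column≤r p = let k , Mₖ≡0 = column-has-zero p in
    ℕ.≤-trans (∑-≤-vanishing (λ k → M k p) k (λ k → M≤1 k p) Mₖ≡0)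
              (ℕ.≤-reflexive (ℕ.*-identityʳ r))

dim-three-bound : ∀ {q n d} (F : FiniteField q) → let open Codes F in
  ∀ {E : Code (suc n)} → IsLinear E → HasDimension E 3 →
  (∀ c → E c → ¬ IsZeroWord c → d ≤ wt c) →
  ∀ w → dual E w → wt w ≡ 2 → suc q * d + (q + q) ≤ suc n * q
dim-three-bound {q} {n} {d} F E-linear E-dim d≤wt w w∈E⊥ wt≡2 =
  double-count M i j M≤1 d≤row covers (λ k → wt₁-zero (line-vanishes k))
    (λ k → wt₁-zero (propagates (line k) (line-∈ k) (line-vanishes k)))
  where
  open Codes F
  open FieldLemmas F
  support = dual-weight-two-propagates w w∈E⊥ wt≡2
  i = proj₁ support
  j = proj₁ (proj₂ support)
  propagates = proj₂ (proj₂ support)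
  open Line E-linear (pencil E-linear E-dim i)
  M : Fin (suc q) → Fin (suc n) → ℕ
  M k p = wt₁ (line k p)
  M≤1 : ∀ k p → M k p ≤ 1
  M≤1 k p = wt₁-≤1 (line k p)
  d≤row : ∀ k → d ≤ sum (M k)
  d≤row k = subst (d ≤_) (wt≡∑wt₁ (line k)) (d≤wt (line k) (line-∈ k) (line≢0 k))
  covers : ∀ p → ∃ λ k → M k p ≡ 0
  covers p = let k , lineₖₚ≡0 = line-covers p in k , wt₁-zero lineₖₚ≡0

dim-three-bound-violated : ∀ q s → 0 < q →
  let N = (q + 1) * suc s in ¬ (suc q * (N + 1 ∸ suc (suc s)) + (q + q) ≤ suc N * q)
dim-three-bound-violated (suc q′) s _ bound =
  ℕ.m+1+n≰m (suc N * q) (subst (_≤ suc N * q) excess bound)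
  where
  open +-*-Solver
  q = suc q′
  N = (q + 1) * suc s
  d≡qs : N + 1 ∸ suc (suc s) ≡ q * suc s
  d≡qs = trans (cong (_∸ suc (suc s)) (solve 2 (λ q s → (q :+ con 1) :* (con 1 :+ s) :+ con 1
                                                 := q :* (con 1 :+ s) :+ (con 2 :+ s)) refl q s))
               (ℕ.m+n∸n≡m (q * suc s) (suc (suc s)))
  excess : suc q * (N + 1 ∸ suc (suc s)) + (q + q) ≡ suc N * q + suc q′
  excess = trans (cong (λ d → suc q * d + (q + q)) d≡qs)
    (solve 2 (λ q s → (con 1 :+ q) :* (q :* (con 1 :+ s)) :+ (q :+ q)
                    := (con 1 :+ (q :+ con 1) :* (con 1 :+ s)) :* q :+ q) refl q s)

lemma3 : (m t : ℕ) (F : FiniteField (2 ^ m)) → 1 < t → t < 2 ^ m →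
    let open Codes F
        N = (2 ^ m + 1) * (t ∸ 1)
    in ¬ (∃ λ (C : Code N) →
           IsCyclic C ×
           HasParams (extend C) 3 (N + 1 ∸ t) ×
           HasMinDistance (dual (extend C)) 2)
lemma3 m zero          F ()        _
lemma3 m (suc zero)    F (s≤s ())  _
lemma3 m (suc (suc s)) F _ t<q
  (_ , _ , (E-linear , E-dim , _ , d≤wt) , (w , w∈E⊥ , _ , wt≡2) , _) =
  dim-three-bound-violated (2 ^ m) s (ℕ.<-trans (s≤s z≤n) t<q)
    (dim-three-bound F E-linear E-dim d≤wt w w∈E⊥ wt≡2)
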